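{- Let $\mathbf{a}=(a_n)_{n\geq 1}$ be a strong divisibility sequence. Then for every positive integer $n$, \[\mathrm{lcm}(a_1,a_2,\dots,a_n)=\gcd\left\{\binom{n}{k}_{\mathbf{a}}\,\mathrm{lcm}(a_1,\dots,a_k)\ ;\ k\in\mathbb{N},\ n/2\leq k\leq n\right\}.\]
   Context: A strong divisibility sequence is a sequence of positive integers $(a_n)_{n\geq 1}$ such that $\gcd(a_n,a_m)=a_{\gcd(n,m)}$ for all positive integers $n,m$. For $n,k\in\mathbb{N}$ with $n\geq k$, the $\mathbf{a}$-binomial coefficient is $\binom{n}{k}_{\mathbf{a}}:=\frac{a_na_{n-1}\cdots a_{n-k+1}}{a_1a_2\cdots a_k}$ (an empty product being $1$); for strong divisibility sequences these are positive integers. -}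

module Defs where

open import Data.Nat using (ℕ; zero; suc; _+_; _*_; _∸_; _≤_; _≤?_; NonZero)
open import Data.Nat.DivMod using (_/_)
open import Data.Nat.GCD using (gcd)
open import Data.Nat.LCM using (lcm)
open import Relation.Nullary using (yes; no)
open import Relation.Binary.PropositionalEquality using (_≡_)

-- Sequences a = (a_n)_{n ≥ 1} are modelled as functions ℕ → ℕ; the value a 0 is irrelevant.

record IsStrongDivSeq (a : ℕ → ℕ) : Set where
  field
    positive : ∀ n → 1 ≤ n → 1 ≤ a n
    strong   : ∀ n m → 1 ≤ n → 1 ≤ m → gcd (a n) (a m) ≡ a (gcd n m)

-- total division: m / d for d ≠ 0, and 0 when d = 0 (never used with d = 0 under the hypotheses)
_div_ : ℕ → ℕ → ℕ
m div zero    = zero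
m div (suc d) = m / suc d

fallingProd : (ℕ → ℕ) → ℕ → ℕ → ℕ
fallingProd a n zero    = 1
fallingProd a n (suc k) = a (n ∸ k) * fallingProd a n k

prefixProd : (ℕ → ℕ) → ℕ → ℕ
prefixProd a zero    = 1
prefixProd a (suc k) = prefixProd a k * a (suc k)

binomA : (ℕ → ℕ) → ℕ → ℕ → ℕ
binomA a n k = fallingProd a n k div prefixProd a k

lcmUpTo : (ℕ → ℕ) → ℕ → ℕ
lcmUpTo a zero    = 1
lcmUpTo a (suc k) = lcm (lcmUpTo a k) (a (suc k))

-- gcd of f k over k ≤ m with n ≤ 2k  (0 is the neutral element for gcd)
gcdHalf : (ℕ → ℕ) → ℕ → ℕ → ℕ
gcdHalf f n zero with n ≤? 0
... | yes _ = f 0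
... | no  _ = 0
gcdHalf f n (suc m) with n ≤? suc m + suc m
... | yes _ = gcd (gcdHalf f n m) (f (suc m))
... | no  _ = gcdHalf f n m

module Submission where

-- Fix a prime p and put f j = ν_p(a_j). Because a is a strong divisibility sequence, f carries gcd
-- to min, and so does each level indicator [t ≤ f]; such an indicator is either zero on [1, k] or,
-- on [1, N], the indicator of the multiples of a single r ≤ k. Writing f as the sum of its levels,
-- inequalities between sums and maxima of f over initial segments reduce to these indicators, where
-- they become statements about ⌊x/r⌋. This gives
--   ν_p(a_1⋯a_m · a_1⋯a_k) ≤ ν_p(a_1⋯a_{m+k})                                  (integrality),
--   ν_p(a_1⋯a_m · a_1⋯a_k · a_i) ≤ ν_p(a_1⋯a_{m+k} · lcm(a_1,…,a_k))   for m < i ≤ m + k,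
-- the extra term f i being paid for by max_{j≤k} f j. With n = m + k and m ≤ k, every a_i with
-- i ≤ n thus divides (n choose k)_a · lcm(a_1,…,a_k), while the term k = n of the gcd is
-- lcm(a_1,…,a_n) itself.

open import Defs
open import Data.Nat using (ℕ; _≤_; _*_)
open import Relation.Binary.PropositionalEquality using (_≡_)
open import Data.Bool using (if_then_else_)
open import Data.List using (_∷_)
open import Data.List.Relation.Unary.All using (All; []; _∷_)
open import Data.Nat
open import Data.Nat.Divisibility
open import Data.Nat.DivMod hiding (_div_)
open import Data.Nat.GCD
open import Data.Nat.LCM
open import Data.Nat.ListAction using (product)
open import Data.Nat.Primality using (Prime; prime⇒nonTrivial; prime⇒nonZero; euclidsLemma; productOfPrimes≥1)
open import Data.Nat.Primality.Factorisation
open import Data.Nat.Properties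
open import Algebra.Properties.CommutativeSemigroup +-commutativeSemigroup using (interchange; xy∙z≈xz∙y; x∙yz≈xz∙y)
open import Algebra.Properties.CommutativeSemigroup *-commutativeSemigroup using () renaming (interchange to *-interchange)
open import Data.Product using (∃-syntax; _×_; _,_)
open import Data.Sum using (_⊎_; inj₁; inj₂; [_,_]′)
open import Function using (_∘_)
open import Relation.Binary.Core using (_Preserves_⟶_)
open import Relation.Binary.PropositionalEquality
open import Relation.Nullary using (¬_; does; yes; no; contradiction)
open import Relation.Nullary.Decidable using (dec-true; dec-false)

∣⇒>0 : ∀ {m n} → 0 < n → m ∣ n → 0 < m
∣⇒>0 {zero}  0<n 0∣n = contradiction (0∣⇒≡0 0∣n) (n>0⇒n≢0 0<n)
∣⇒>0 {suc m} _   _   = z<s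

*-pres->0 : ∀ {m n} → 0 < m → 0 < n → 0 < m * n
*-pres->0 = *-mono-≤

gcd>0 : ∀ {m} n → 0 < m → 0 < gcd m n
gcd>0 n 0<m = ∣⇒>0 0<m (gcd[m,n]∣m _ n)

sumUpTo : (ℕ → ℕ) → ℕ → ℕ
sumUpTo f zero    = 0
sumUpTo f (suc n) = sumUpTo f n + f (suc n)

maxUpTo : (ℕ → ℕ) → ℕ → ℕ
maxUpTo f zero    = 0
maxUpTo f (suc n) = maxUpTo f n ⊔ f (suc n)

sumUpTo-cong : ∀ {f g} n → (∀ x → 0 < x → x ≤ n → f x ≡ g x) → sumUpTo f n ≡ sumUpTo g n
sumUpTo-cong zero    _   = refl
sumUpTo-cong (suc n) f≡g =
  cong₂ _+_ (sumUpTo-cong n (λ x 0<x x≤n → f≡g x 0<x (m≤n⇒m≤1+n x≤n))) (f≡g (suc n) z<s ≤-refl)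

sumUpTo-zero : ∀ {f} n → (∀ x → 0 < x → x ≤ n → f x ≡ 0) → sumUpTo f n ≡ 0
sumUpTo-zero zero    _   = refl
sumUpTo-zero (suc n) f≡0 =
  cong₂ _+_ (sumUpTo-zero n (λ x 0<x x≤n → f≡0 x 0<x (m≤n⇒m≤1+n x≤n))) (f≡0 (suc n) z<s ≤-refl)

sumUpTo-distrib-+ : ∀ f g n → sumUpTo (λ x → f x + g x) n ≡ sumUpTo f n + sumUpTo g n
sumUpTo-distrib-+ f g zero    = refl
sumUpTo-distrib-+ f g (suc n) =
  trans (cong (_+ (f (suc n) + g (suc n))) (sumUpTo-distrib-+ f g n))
        (interchange (sumUpTo f n) (sumUpTo g n) (f (suc n)) (g (suc n)))

sumUpTo-mono : ∀ f {m n} → m ≤ n → sumUpTo f m ≤ sumUpTo f n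
sumUpTo-mono f {n = zero}  z≤n   = ≤-refl
sumUpTo-mono f {n = suc n} m≤1+n with m≤n⇒m<n∨m≡n m≤1+n
... | inj₁ m<1+n = ≤-trans (sumUpTo-mono f (s≤s⁻¹ m<1+n)) (m≤m+n _ _)
... | inj₂ refl  = ≤-refl

sumUpTo+term≤sumUpTo : ∀ f {m i n} → m < i → i ≤ n → sumUpTo f m + f i ≤ sumUpTo f n
sumUpTo+term≤sumUpTo f {n = zero}  (s≤s _) ()
sumUpTo+term≤sumUpTo f {n = suc n} m<i i≤1+n with m≤n⇒m<n∨m≡n i≤1+n
... | inj₁ i<1+n = ≤-trans (sumUpTo+term≤sumUpTo f m<i (s≤s⁻¹ i<1+n)) (m≤m+n _ _)
... | inj₂ refl  = +-monoˡ-≤ (f (suc n)) (sumUpTo-mono f (s≤s⁻¹ m<i))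

f≤maxUpTo : ∀ f {x n} → 0 < x → x ≤ n → f x ≤ maxUpTo f n
f≤maxUpTo f {n = zero}  (s≤s _) ()
f≤maxUpTo f {n = suc n} 0<x x≤1+n with m≤n⇒m<n∨m≡n x≤1+n
... | inj₁ x<1+n = ≤-trans (f≤maxUpTo f 0<x (s≤s⁻¹ x<1+n)) (m≤m⊔n _ _)
... | inj₂ refl  = m≤n⊔m _ _

maxUpTo-lub : ∀ f n {b} → (∀ x → 0 < x → x ≤ n → f x ≤ b) → maxUpTo f n ≤ b
maxUpTo-lub f zero    _   = z≤n
maxUpTo-lub f (suc n) f≤b =
  ⊔-lub (maxUpTo-lub f n (λ x 0<x x≤n → f≤b x 0<x (m≤n⇒m≤1+n x≤n))) (f≤b (suc n) z<s ≤-refl)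

maxUpTo-∘ : ∀ {φ} → φ 0 ≡ 0 → φ Preserves _≤_ ⟶ _≤_ →
            ∀ f n → maxUpTo (φ ∘ f) n ≡ φ (maxUpTo f n)
maxUpTo-∘ φ0≡0 φ-mono f zero    = sym φ0≡0
maxUpTo-∘ {φ} φ0≡0 φ-mono f (suc n) =
  trans (cong (_⊔ φ (f (suc n))) (maxUpTo-∘ φ0≡0 φ-mono f n)) (sym (mono-≤-distrib-⊔ φ-mono _ _))

isMultiple : ℕ → ℕ → ℕ
isMultiple r x = if does (r ∣? x) then 1 else 0

isMultiple-yes : ∀ {r x} → r ∣ x → isMultiple r x ≡ 1
isMultiple-yes {r} {x} r∣x rewrite dec-true (r ∣? x) r∣x = refl

isMultiple-no : ∀ {r x} → ¬ r ∣ x → isMultiple r x ≡ 0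
isMultiple-no {r} {x} r∤x rewrite dec-false (r ∣? x) r∤x = refl

isMultiple-+ : ∀ r x → isMultiple r (x + r) ≡ isMultiple r x
isMultiple-+ r x with r ∣? x
... | yes r∣x = isMultiple-yes (∣m∣n⇒∣m+n r∣x ∣-refl)
... | no  r∤x = isMultiple-no (λ r∣x+r → r∤x (∣m+n∣m⇒∣n (subst (r ∣_) (+-comm x r) r∣x+r) ∣-refl))

sumUpTo-isMultiple-below : ∀ r {s} → s < r → sumUpTo (isMultiple r) s ≡ 0
sumUpTo-isMultiple-below r s<r = sumUpTo-zero _ λ x 0<x x≤s →
  isMultiple-no (λ r∣x → <⇒≱ (≤-<-trans x≤s s<r) (∣⇒≤ {{>-nonZero 0<x}} r∣x))

sumUpTo-isMultiple-+ : ∀ r m → sumUpTo (isMultiple (suc r)) (m + suc r) ≡ sumUpTo (isMultiple (suc r)) m + 1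
sumUpTo-isMultiple-+ r zero =
  cong₂ _+_ (sumUpTo-isMultiple-below (suc r) ≤-refl) (isMultiple-yes (∣-refl {suc r}))
sumUpTo-isMultiple-+ r (suc m) = begin
  sumUpTo χ (m + suc r) + χ (suc m + suc r)
    ≡⟨ cong₂ _+_ (sumUpTo-isMultiple-+ r m) (isMultiple-+ (suc r) (suc m)) ⟩
  sumUpTo χ m + 1 + χ (suc m)               ≡⟨ xy∙z≈xz∙y (sumUpTo χ m) 1 (χ (suc m)) ⟩
  sumUpTo χ m + χ (suc m) + 1               ∎
  where
  open ≡-Reasoning
  χ : ℕ → ℕ
  χ = isMultiple (suc r)

sumUpTo-isMultiple-blocks : ∀ r q {s} → s < suc r → sumUpTo (isMultiple (suc r)) (s + q * suc r) ≡ q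
sumUpTo-isMultiple-blocks r zero    {s} s<r =
  trans (cong (sumUpTo _) (+-identityʳ s)) (sumUpTo-isMultiple-below (suc r) s<r)
sumUpTo-isMultiple-blocks r (suc q) {s} s<r = begin
  sumUpTo χ (s + (suc r + q * suc r)) ≡⟨ cong (sumUpTo χ) (x∙yz≈xz∙y s (suc r) (q * suc r)) ⟩
  sumUpTo χ (s + q * suc r + suc r)   ≡⟨ sumUpTo-isMultiple-+ r (s + q * suc r) ⟩
  sumUpTo χ (s + q * suc r) + 1       ≡⟨ cong (_+ 1) (sumUpTo-isMultiple-blocks r q s<r) ⟩
  q + 1                               ≡⟨ +-comm q 1 ⟩
  suc q                               ∎
  where
  open ≡-Reasoning
  χ : ℕ → ℕ
  χ = isMultiple (suc r)

sumUpTo-isMultiple : ∀ r n → sumUpTo (isMultiple (suc r)) n ≡ n / suc r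
sumUpTo-isMultiple r n = trans (cong (sumUpTo _) (m≡m%n+[m/n]*n n (suc r)))
                               (sumUpTo-isMultiple-blocks r (n / suc r) (m%n<n n (suc r)))

/-superadditive : ∀ m n d .{{_ : NonZero d}} → m / d + n / d ≤ (m + n) / d
/-superadditive m n d = begin
  m / d + n / d               ≡⟨ m*n/n≡m (m / d + n / d) d ⟨
  (m / d + n / d) * d / d     ≤⟨ /-monoˡ-≤ d (begin
    (m / d + n / d) * d         ≡⟨ *-distribʳ-+ d (m / d) (n / d) ⟩
    m / d * d + n / d * d       ≤⟨ +-mono-≤ (m/n*n≤m m d) (m/n*n≤m n d) ⟩
    m + n                       ∎) ⟩
  (m + n) / d                 ∎
  where open ≤-Reasoning

GcdToMin : (ℕ → ℕ) → Set
GcdToMin f = ∀ i j → 0 < i → 0 < j → f (gcd i j) ≡ f i ⊓ f j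

GcdToMin-∘ : ∀ {φ f} → φ Preserves _≤_ ⟶ _≤_ → GcdToMin f → GcdToMin (φ ∘ f)
GcdToMin-∘ {φ} φ-mono f-min i j 0<i 0<j =
  trans (cong φ (f-min i j 0<i 0<j)) (mono-≤-distrib-⊓ φ-mono _ _)

GcdToMin-mono-∣ : ∀ {f x y} → GcdToMin f → 0 < x → 0 < y → x ∣ y → f x ≤ f y
GcdToMin-mono-∣ {f} {x} {y} f-min 0<x 0<y x∣y = begin
  f x             ≡⟨ cong f (∣-antisym (gcd-greatest ∣-refl x∣y) (gcd[m,n]∣m x y)) ⟩
  f (gcd x y)     ≡⟨ f-min x y 0<x 0<y ⟩
  f x ⊓ f y       ≤⟨ m⊓n≤n (f x) (f y) ⟩
  f y             ∎
  where open ≤-Reasoning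

leastPositiveUpTo : ∀ (h : ℕ → ℕ) k → (∀ x → 0 < x → x ≤ k → h x ≡ 0)
                          ⊎ ∃[ r ] (0 < r × r ≤ k × 0 < h r × ∀ x → 0 < x → x < r → h x ≡ 0)
leastPositiveUpTo h zero = inj₁ λ x 0<x x≤0 → contradiction x≤0 (<⇒≱ 0<x)
leastPositiveUpTo h (suc k) with leastPositiveUpTo h k
... | inj₂ (r , 0<r , r≤k , 0<hr , below) = inj₂ (r , 0<r , m≤n⇒m≤1+n r≤k , 0<hr , below)
... | inj₁ h≡0 with h (suc k) in hk
...   | zero  = inj₁ λ x 0<x x≤1+k →
  [ (λ x<1+k → h≡0 x 0<x (s≤s⁻¹ x<1+k)) , (λ { refl → hk }) ]′ (m≤n⇒m<n∨m≡n x≤1+k)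
...   | suc _ = inj₂ (suc k , z<s , ≤-refl , subst (0 <_) (sym hk) z<s ,
                    λ x 0<x x<1+k → h≡0 x 0<x (s≤s⁻¹ x<1+k))

⊓≡0⇒≡0 : ∀ {m n} → 0 < m → m ⊓ n ≡ 0 → n ≡ 0
⊓≡0⇒≡0 {suc m} {zero}  _ _  = refl
⊓≡0⇒≡0 {suc m} {suc n} _ ()

GcdToMin-zeroOne : ∀ {h N k} → GcdToMin h → (∀ x → 0 < x → x ≤ N → h x ≤ 1) → k ≤ N →
                   (∀ x → 0 < x → x ≤ k → h x ≡ 0)
                   ⊎ ∃[ r ] (0 < r × r ≤ k × ∀ x → 0 < x → x ≤ N → h x ≡ isMultiple r x)
GcdToMin-zeroOne {h} {N} {k} h-min h≤1 k≤N with leastPositiveUpTo h k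
... | inj₁ h≡0 = inj₁ h≡0
... | inj₂ (r , 0<r , r≤k , 0<hr , below) = inj₂ (r , 0<r , r≤k , h≡isMultiple)
  where
  h≡isMultiple : ∀ x → 0 < x → x ≤ N → h x ≡ isMultiple r x
  h≡isMultiple x 0<x x≤N with r ∣? x
  ... | yes r∣x = ≤-antisym (h≤1 x 0<x x≤N) (≤-trans 0<hr (GcdToMin-mono-∣ h-min 0<r 0<x r∣x))
  ... | no  r∤x = ⊓≡0⇒≡0 0<hr (trans (sym (h-min r x 0<r 0<x)) (below _ (gcd>0 x 0<r) gcd<r))
    where
    gcd<r : gcd r x < r
    gcd<r = ≤∧≢⇒< (∣⇒≤ {{>-nonZero 0<r}} (gcd[m,n]∣m r x))
                  (λ gcd≡r → r∤x (subst (_∣ x) gcd≡r (gcd[m,n]∣n r x)))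

LevelAdditive : ((ℕ → ℕ) → ℕ) → Set
LevelAdditive L = ∀ f → L f ≡ L (λ x → f x ⊓ 1) + L (λ x → pred (f x))

m≡m⊓1+pred[m] : ∀ m → m ≡ m ⊓ 1 + pred m
m≡m⊓1+pred[m] zero    = refl
m≡m⊓1+pred[m] (suc m) rewrite ⊓-zeroʳ m = refl

value-levelAdditive : ∀ i → LevelAdditive (λ f → f i)
value-levelAdditive i f = m≡m⊓1+pred[m] (f i)

sumUpTo-levelAdditive : ∀ n → LevelAdditive (λ f → sumUpTo f n)
sumUpTo-levelAdditive n f =
  trans (sumUpTo-cong n (λ x _ _ → m≡m⊓1+pred[m] (f x))) (sumUpTo-distrib-+ _ _ n)

maxUpTo-levelAdditive : ∀ n → LevelAdditive (λ f → maxUpTo f n)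
maxUpTo-levelAdditive n f = trans (m≡m⊓1+pred[m] (maxUpTo f n))
  (sym (cong₂ _+_ (maxUpTo-∘ refl (⊓-monoˡ-≤ 1) f n) (maxUpTo-∘ refl pred-mono-≤ f n)))

+-levelAdditive : ∀ {L L′} → LevelAdditive L → LevelAdditive L′ → LevelAdditive (λ f → L f + L′ f)
+-levelAdditive {L} {L′} L-additive L′-additive f =
  trans (cong₂ _+_ (L-additive f) (L′-additive f))
        (interchange (L (λ x → f x ⊓ 1)) (L (λ x → pred (f x)))
                     (L′ (λ x → f x ⊓ 1)) (L′ (λ x → pred (f x))))

-- Since m = m ⊓ 1 + pred m and both parts of a gcd-to-min function are again gcd-to-min,
-- induction on a bound for f on [1, N] reduces L f ≤ R f to 0/1-valued functions.
module _ (N : ℕ) {L R : (ℕ → ℕ) → ℕ} (L-additive : LevelAdditive L) (R-additive : LevelAdditive R)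
         (zeroOne : ∀ h → GcdToMin h → (∀ x → 0 < x → x ≤ N → h x ≤ 1) → L h ≤ R h) where

  ≤-byLevels : ∀ f → GcdToMin f → L f ≤ R f
  ≤-byLevels f f-min = bounded (maxUpTo f N) f f-min (λ x 0<x x≤N → f≤maxUpTo f 0<x x≤N)
    where
    bounded : ∀ B f → GcdToMin f → (∀ x → 0 < x → x ≤ N → f x ≤ B) → L f ≤ R f
    bounded zero    f f-min f≤0   = zeroOne f f-min (λ x 0<x x≤N → ≤-trans (f≤0 x 0<x x≤N) z≤n)
    bounded (suc B) f f-min f≤1+B = begin
      L f                                           ≡⟨ L-additive f ⟩
      L (λ x → f x ⊓ 1) + L (λ x → pred (f x))      ≤⟨ +-mono-≤ bottomLevel upperLevels ⟩
      R (λ x → f x ⊓ 1) + R (λ x → pred (f x))      ≡⟨ R-additive f ⟨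
      R f                                           ∎
      where
      open ≤-Reasoning
      bottomLevel : L (λ x → f x ⊓ 1) ≤ R (λ x → f x ⊓ 1)
      bottomLevel = zeroOne _ (GcdToMin-∘ (⊓-monoˡ-≤ 1) f-min) (λ x _ _ → m⊓n≤n (f x) 1)
      upperLevels : L (λ x → pred (f x)) ≤ R (λ x → pred (f x))
      upperLevels = bounded B _ (GcdToMin-∘ pred-mono-≤ f-min)
                            (λ x 0<x x≤N → pred-mono-≤ (f≤1+B x 0<x x≤N))

sumUpTo-superadditive : ∀ {f} → GcdToMin f → ∀ m k → sumUpTo f m + sumUpTo f k ≤ sumUpTo f (m + k)
sumUpTo-superadditive {f} f-min m k =
  ≤-byLevels (m + k) (+-levelAdditive (sumUpTo-levelAdditive m) (sumUpTo-levelAdditive k))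
             (sumUpTo-levelAdditive (m + k)) zeroOne f f-min
  where
  zeroOne : ∀ h → GcdToMin h → (∀ x → 0 < x → x ≤ m + k → h x ≤ 1) →
            sumUpTo h m + sumUpTo h k ≤ sumUpTo h (m + k)
  zeroOne h h-min h≤1 with GcdToMin-zeroOne h-min h≤1 (m≤n+m k m)
  ... | inj₁ h≡0 = begin
    sumUpTo h m + sumUpTo h k  ≡⟨ cong (sumUpTo h m +_) (sumUpTo-zero k h≡0) ⟩
    sumUpTo h m + 0            ≡⟨ +-identityʳ _ ⟩
    sumUpTo h m                ≤⟨ sumUpTo-mono h (m≤m+n m k) ⟩
    sumUpTo h (m + k)          ∎
    where open ≤-Reasoning
  ... | inj₂ (suc r , _ , _ , h≡isMultiple) = begin
    sumUpTo h m + sumUpTo h k            ≡⟨ cong₂ _+_ (sumUpTo-h m (m≤m+n m k)) (sumUpTo-h k (m≤n+m k m)) ⟩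
    m / suc r + k / suc r                ≤⟨ /-superadditive m k (suc r) ⟩
    (m + k) / suc r                      ≡⟨ sumUpTo-h (m + k) ≤-refl ⟨
    sumUpTo h (m + k)                    ∎
    where
    open ≤-Reasoning
    sumUpTo-h : ∀ n → n ≤ m + k → sumUpTo h n ≡ n / suc r
    sumUpTo-h n n≤N = trans (sumUpTo-cong n (λ x 0<x x≤n → h≡isMultiple x 0<x (≤-trans x≤n n≤N)))
                            (sumUpTo-isMultiple r n)

sumUpTo-superadditive+term : ∀ {f} → GcdToMin f → ∀ {m k i} → m < i → i ≤ m + k →
  sumUpTo f m + sumUpTo f k + f i ≤ sumUpTo f (m + k) + maxUpTo f k
sumUpTo-superadditive+term {f} f-min {m} {k} {i} m<i i≤N =
  ≤-byLevels (m + k)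
    (+-levelAdditive (+-levelAdditive (sumUpTo-levelAdditive m) (sumUpTo-levelAdditive k)) (value-levelAdditive i))
    (+-levelAdditive (sumUpTo-levelAdditive (m + k)) (maxUpTo-levelAdditive k)) zeroOne f f-min
  where
  zeroOne : ∀ h → GcdToMin h → (∀ x → 0 < x → x ≤ m + k → h x ≤ 1) →
            sumUpTo h m + sumUpTo h k + h i ≤ sumUpTo h (m + k) + maxUpTo h k
  zeroOne h h-min h≤1 with GcdToMin-zeroOne h-min h≤1 (m≤n+m k m)
  ... | inj₁ h≡0 = begin
    sumUpTo h m + sumUpTo h k + h i  ≡⟨ cong (λ s → sumUpTo h m + s + h i) (sumUpTo-zero k h≡0) ⟩
    sumUpTo h m + 0 + h i            ≡⟨ cong (_+ h i) (+-identityʳ _) ⟩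
    sumUpTo h m + h i                ≤⟨ sumUpTo+term≤sumUpTo h m<i i≤N ⟩
    sumUpTo h (m + k)                ≤⟨ m≤m+n _ _ ⟩
    sumUpTo h (m + k) + maxUpTo h k  ∎
    where open ≤-Reasoning
  ... | inj₂ (r , 0<r , r≤k , h≡isMultiple) = +-mono-≤ (sumUpTo-superadditive h-min m k) (begin
    h i           ≤⟨ h≤1 i (≤-<-trans z≤n m<i) i≤N ⟩
    1             ≡⟨ trans (h≡isMultiple r 0<r (≤-trans r≤k (m≤n+m k m))) (isMultiple-yes (∣-refl {r})) ⟨
    h r           ≤⟨ f≤maxUpTo h 0<r r≤k ⟩
    maxUpTo h k   ∎)
    where open ≤-Reasoning

^-monoʳ-∣ : ∀ p {e f} → e ≤ f → p ^ e ∣ p ^ f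
^-monoʳ-∣ p {e} {f} e≤f = divides (p ^ (f ∸ e)) (begin
  p ^ f               ≡⟨ cong (p ^_) (m∸n+n≡m e≤f) ⟨
  p ^ (f ∸ e + e)     ≡⟨ ^-distribˡ-+-* p (f ∸ e) e ⟩
  p ^ (f ∸ e) * p ^ e ∎)
  where open ≡-Reasoning

-- For p > 1, x itself is enough fuel, as every step divides by p. Junk value: ν p 0 = 0.
νWithFuel : ℕ → ℕ → ℕ → ℕ
νWithFuel p zero       x = 0
νWithFuel p (suc fuel) x with p ∣? x
... | yes p∣x = suc (νWithFuel p fuel (quotient p∣x))
... | no  _   = 0

ν : ℕ → ℕ → ℕ
ν p x = νWithFuel p x x

module _ {p} .{{_ : NonTrivial p}} where

  private instance
    p≢0 : NonZero p
    p≢0 = nonTrivial⇒nonZero p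

  νWithFuel-spec : ∀ fuel {x} → 0 < x → x ≤ fuel → ∃[ u ] x ≡ p ^ νWithFuel p fuel x * u × ¬ p ∣ u
  νWithFuel-spec zero       (s≤s _) ()
  νWithFuel-spec (suc fuel) {x} 0<x x≤1+fuel with p ∣? x
  ... | no  p∤x = x , sym (*-identityˡ x) , p∤x
  ... | yes (divides q x≡q*p) with νWithFuel-spec fuel 0<q q≤fuel
    where
    0<q : 0 < q
    0<q = ∣⇒>0 0<x (divides p (trans x≡q*p (*-comm q p)))
    q≤fuel : q ≤ fuel
    q≤fuel = s≤s⁻¹ (≤-trans (m<m*n q p {{>-nonZero 0<q}} (nonTrivial⇒n>1 p))
                            (≤-trans (≤-reflexive (sym x≡q*p)) x≤1+fuel))
  ... | u , q≡p^e*u , p∤u = u , (begin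
    x                 ≡⟨ x≡q*p ⟩
    q * p             ≡⟨ cong (_* p) q≡p^e*u ⟩
    p ^ e * u * p     ≡⟨ *-comm (p ^ e * u) p ⟩
    p * (p ^ e * u)   ≡⟨ *-assoc p (p ^ e) u ⟨
    p * p ^ e * u     ∎) , p∤u
    where
    open ≡-Reasoning
    e : ℕ
    e = νWithFuel p fuel q

  ν-spec : ∀ {x} → 0 < x → ∃[ u ] x ≡ p ^ ν p x * u × ¬ p ∣ u
  ν-spec 0<x = νWithFuel-spec _ 0<x ≤-refl

  ^∣^*⇒≤ : ∀ {e c u} → ¬ p ∣ u → p ^ e ∣ p ^ c * u → e ≤ c
  ^∣^*⇒≤ {e} {c} {u} p∤u p^e∣p^c*u with e ≤? c
  ... | yes e≤c = e≤c
  ... | no  e≰c = contradiction (*-cancelˡ-∣ (p ^ c) {{m^n≢0 p c}} p^c*p∣p^c*u) p∤u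
    where
    p^c*p∣p^c*u : p ^ c * p ∣ p ^ c * u
    p^c*p∣p^c*u = subst (_∣ p ^ c * u) (*-comm p (p ^ c)) (∣-trans (^-monoʳ-∣ p (≰⇒> e≰c)) p^e∣p^c*u)

  ^∣⇒≤ν : ∀ {e x} → 0 < x → p ^ e ∣ x → e ≤ ν p x
  ^∣⇒≤ν {e} 0<x p^e∣x with ν-spec 0<x
  ... | u , x≡p^ν*u , p∤u = ^∣^*⇒≤ p∤u (subst (p ^ e ∣_) x≡p^ν*u p^e∣x)

  ≤ν⇒^∣ : ∀ {e x} → 0 < x → e ≤ ν p x → p ^ e ∣ x
  ≤ν⇒^∣ {x = x} 0<x e≤ν with ν-spec 0<x
  ... | u , x≡p^ν*u , _ = ∣-trans (^-monoʳ-∣ p e≤ν) (subst (p ^ ν p x ∣_) (sym x≡p^ν*u) (m∣m*n u))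

  ν-unique : ∀ {x c u} → 0 < x → x ≡ p ^ c * u → ¬ p ∣ u → ν p x ≡ c
  ν-unique {x} {c} {u} 0<x x≡p^c*u p∤u = ≤-antisym
    (^∣^*⇒≤ p∤u (subst (p ^ ν p x ∣_) x≡p^c*u (≤ν⇒^∣ 0<x ≤-refl)))
    (^∣⇒≤ν 0<x (subst (p ^ c ∣_) (sym x≡p^c*u) (m∣m*n u)))

  ν[1]≡0 : ν p 1 ≡ 0
  ν[1]≡0 = ν-unique z<s refl (λ p∣1 → <⇒≢ (nonTrivial⇒n>1 p) (sym (∣1⇒≡1 p∣1)))

  ν-mono-∣ : ∀ {x y} → 0 < y → x ∣ y → ν p x ≤ ν p y
  ν-mono-∣ 0<y x∣y = ^∣⇒≤ν 0<y (∣-trans (≤ν⇒^∣ (∣⇒>0 0<y x∣y) ≤-refl) x∣y)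

  ν-gcd : ∀ {x y} → 0 < x → 0 < y → ν p (gcd x y) ≡ ν p x ⊓ ν p y
  ν-gcd {x} {y} 0<x 0<y = ≤-antisym
    (⊓-glb (ν-mono-∣ 0<x (gcd[m,n]∣m x y)) (ν-mono-∣ 0<y (gcd[m,n]∣n x y)))
    (^∣⇒≤ν (gcd>0 y 0<x) (gcd-greatest (≤ν⇒^∣ 0<x (m⊓n≤m (ν p x) (ν p y)))
                                       (≤ν⇒^∣ 0<y (m⊓n≤n (ν p x) (ν p y)))))

  p∣⇒ν>0 : ∀ {x} → 0 < x → p ∣ x → 0 < ν p x
  p∣⇒ν>0 0<x p∣x = ^∣⇒≤ν 0<x (∣-trans (∣-reflexive (*-identityʳ p)) p∣x)

  ν>0⇒p∣ : ∀ {x} → 0 < x → 0 < ν p x → p ∣ x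
  ν>0⇒p∣ 0<x 0<ν = ∣-trans (∣-reflexive (sym (*-identityʳ p))) (≤ν⇒^∣ 0<x 0<ν)

module _ {p} (p-prime : Prime p) where

  private instance
    p-nonTrivial : NonTrivial p
    p-nonTrivial = prime⇒nonTrivial p-prime

  ν-* : ∀ {x y} → 0 < x → 0 < y → ν p (x * y) ≡ ν p x + ν p y
  ν-* {x} {y} 0<x 0<y with ν-spec 0<x | ν-spec 0<y
  ... | u , x≡p^νx*u , p∤u | w , y≡p^νy*w , p∤w =
    ν-unique (*-pres->0 0<x 0<y) x*y≡ (λ p∣u*w → [ p∤u , p∤w ]′ (euclidsLemma u w p-prime p∣u*w))
    where
    open ≡-Reasoning
    x*y≡ : x * y ≡ p ^ (ν p x + ν p y) * (u * w)
    x*y≡ = begin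
      x * y                               ≡⟨ cong₂ _*_ x≡p^νx*u y≡p^νy*w ⟩
      p ^ ν p x * u * (p ^ ν p y * w)     ≡⟨ *-interchange (p ^ ν p x) u (p ^ ν p y) w ⟩
      p ^ ν p x * p ^ ν p y * (u * w)     ≡⟨ cong (_* (u * w)) (^-distribˡ-+-* p (ν p x) (ν p y)) ⟨
      p ^ (ν p x + ν p y) * (u * w)       ∎

product-∣-byν : ∀ {ps} → All Prime ps → ∀ {y} → 0 < y →
                (∀ p → Prime p → ν p (product ps) ≤ ν p y) → product ps ∣ y
product-∣-byν []                 {y} _   _   = 1∣ y
product-∣-byν {p ∷ ps} (p-prime ∷ ps-prime) {y} 0<y ν≤ =
  subst (p * product ps ∣_) (sym y≡p*y′) (*-monoʳ-∣ p (product-∣-byν ps-prime 0<y′ ν′≤))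
  where
  instance
    p-nonTrivial : NonTrivial p
    p-nonTrivial = prime⇒nonTrivial p-prime
  0<p : 0 < p
  0<p = >-nonZero⁻¹ p {{prime⇒nonZero p-prime}}
  0<P : 0 < product ps
  0<P = productOfPrimes≥1 ps-prime
  p∣y : p ∣ y
  p∣y = ν>0⇒p∣ 0<y (≤-trans (p∣⇒ν>0 (*-pres->0 0<p 0<P) (m∣m*n (product ps))) (ν≤ p p-prime))
  y′ : ℕ
  y′ = quotient p∣y
  y≡p*y′ : y ≡ p * y′
  y≡p*y′ = m∣n⇒n≡m*quotient p∣y
  0<y′ : 0 < y′
  0<y′ = ∣⇒>0 0<y (quotient-∣ p∣y)
  ν′≤ : ∀ q → Prime q → ν q (product ps) ≤ ν q y′
  ν′≤ q q-prime = +-cancelˡ-≤ (ν q p) _ _ (subst₂ _≤_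
    (ν-* q-prime 0<p 0<P) (trans (cong (ν q) y≡p*y′) (ν-* q-prime 0<p 0<y′)) (ν≤ q q-prime))

∣-byν : ∀ {x y} → 0 < x → 0 < y → (∀ p → Prime p → ν p x ≤ ν p y) → x ∣ y
∣-byν {x} {y} 0<x 0<y ν≤ =
  subst (_∣ y) (sym x≡P) (product-∣-byν factorsPrime 0<y
    (λ p p-prime → subst (λ z → ν p z ≤ ν p y) x≡P (ν≤ p p-prime)))
  where
  open PrimeFactorisation (factorise x {{>-nonZero 0<x}}) renaming (isFactorisation to x≡P)

m-div-n*n≡m : ∀ {m n} → 0 < n → n ∣ m → m div n * n ≡ m
m-div-n*n≡m {n = suc n} _ n∣m = m/n*n≡m n∣m

n-div-n≡1 : ∀ {n} → 0 < n → n div n ≡ 1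
n-div-n≡1 {suc n} _ = n/n≡1 (suc n)

lcm>0 : ∀ {m n} → 0 < m → 0 < n → 0 < lcm m n
lcm>0 {m} {n} 0<m 0<n = n≢0⇒n>0 λ lcm≡0 → n>0⇒n≢0 (*-pres->0 0<m 0<n) (begin
  m * n                 ≡⟨ gcd*lcm m n ⟨
  gcd m n * lcm m n     ≡⟨ cong (gcd m n *_) lcm≡0 ⟩
  gcd m n * 0           ≡⟨ *-zeroʳ (gcd m n) ⟩
  0                     ∎)
  where open ≡-Reasoning

prefixProd-+ : ∀ a m k → prefixProd a (m + k) ≡ prefixProd a m * fallingProd a (m + k) k
prefixProd-+ a m zero    = trans (cong (prefixProd a) (+-identityʳ m)) (sym (*-identityʳ _))
prefixProd-+ a m (suc k) = begin
  prefixProd a (m + suc k)                                     ≡⟨ cong (prefixProd a) (+-suc m k) ⟩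
  prefixProd a (suc m + k)                                     ≡⟨ prefixProd-+ a (suc m) k ⟩
  prefixProd a m * a (suc m) * fallingProd a (suc m + k) k     ≡⟨ *-assoc (prefixProd a m) _ _ ⟩
  prefixProd a m * (a (suc m) * fallingProd a (suc m + k) k)
    ≡⟨ cong (λ j → prefixProd a m * (a j * fallingProd a (suc m + k) k)) (m+n∸n≡m (suc m) k) ⟨
  prefixProd a m * fallingProd a (suc m + k) (suc k)
    ≡⟨ cong (λ n → prefixProd a m * fallingProd a n (suc k)) (+-suc m k) ⟨
  prefixProd a m * fallingProd a (m + suc k) (suc k)           ∎
  where open ≡-Reasoning

a∣lcmUpTo : ∀ a {j k} → 0 < j → j ≤ k → a j ∣ lcmUpTo a k
a∣lcmUpTo a {k = zero}  (s≤s _) ()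
a∣lcmUpTo a {k = suc k} 0<j j≤1+k with m≤n⇒m<n∨m≡n j≤1+k
... | inj₁ j<1+k = ∣-trans (a∣lcmUpTo a 0<j (s≤s⁻¹ j<1+k)) (m∣lcm[m,n] _ _)
... | inj₂ refl  = n∣lcm[m,n] (lcmUpTo a k) _

lcmUpTo-least : ∀ a n {z} → (∀ j → 0 < j → j ≤ n → a j ∣ z) → lcmUpTo a n ∣ z
lcmUpTo-least a zero    _   = 1∣ _
lcmUpTo-least a (suc n) a∣z =
  lcm-least (lcmUpTo-least a n (λ j 0<j j≤n → a∣z j 0<j (m≤n⇒m≤1+n j≤n))) (a∣z (suc n) z<s ≤-refl)

module _ {a : ℕ → ℕ} (positive : ∀ n → 1 ≤ n → 1 ≤ a n) where

  prefixProd>0 : ∀ n → 0 < prefixProd a n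
  prefixProd>0 zero    = z<s
  prefixProd>0 (suc n) = *-pres->0 (prefixProd>0 n) (positive (suc n) z<s)

  lcmUpTo>0 : ∀ n → 0 < lcmUpTo a n
  lcmUpTo>0 zero    = z<s
  lcmUpTo>0 (suc n) = lcm>0 (lcmUpTo>0 n) (positive (suc n) z<s)

  binomA-diag : ∀ n → binomA a n n ≡ 1
  binomA-diag n = begin
    fallingProd a n n div prefixProd a n
      ≡⟨ cong (_div prefixProd a n) (trans (sym (*-identityˡ _)) (sym (prefixProd-+ a 0 n))) ⟩
    prefixProd a n div prefixProd a n            ≡⟨ n-div-n≡1 (prefixProd>0 n) ⟩
    1                                            ∎
    where open ≡-Reasoning

  module _ {p} (p-prime : Prime p) where

    private instance
      p-nonTrivial : NonTrivial p
      p-nonTrivial = prime⇒nonTrivial p-prime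

    ν-prefixProd : ∀ n → ν p (prefixProd a n) ≡ sumUpTo (ν p ∘ a) n
    ν-prefixProd zero    = ν[1]≡0
    ν-prefixProd (suc n) = trans (ν-* p-prime (prefixProd>0 n) (positive (suc n) z<s))
                                 (cong (_+ ν p (a (suc n))) (ν-prefixProd n))

    maxUpTo-ν≤ν-lcmUpTo : ∀ k → maxUpTo (ν p ∘ a) k ≤ ν p (lcmUpTo a k)
    maxUpTo-ν≤ν-lcmUpTo k = maxUpTo-lub _ k (λ j 0<j j≤k → ν-mono-∣ (lcmUpTo>0 k) (a∣lcmUpTo a 0<j j≤k))

module _ {a : ℕ → ℕ} (sds : IsStrongDivSeq a) where

  open IsStrongDivSeq sds

  private
    P : ℕ → ℕ
    P = prefixProd a
    P>0 : ∀ n → 0 < P n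
    P>0 = prefixProd>0 positive
    L>0 : ∀ n → 0 < lcmUpTo a n
    L>0 = lcmUpTo>0 positive
    ν-P : ∀ {p} → Prime p → ∀ n → ν p (P n) ≡ sumUpTo (ν p ∘ a) n
    ν-P = ν-prefixProd positive

  ν-gcdToMin : ∀ {p} → Prime p → GcdToMin (ν p ∘ a)
  ν-gcdToMin {p} p-prime i j 0<i 0<j =
    trans (cong (ν p) (sym (strong i j 0<i 0<j))) (ν-gcd {{prime⇒nonTrivial p-prime}} (positive i 0<i) (positive j 0<j))

  prefixProd*prefixProd∣prefixProd : ∀ m k → prefixProd a m * prefixProd a k ∣ prefixProd a (m + k)
  prefixProd*prefixProd∣prefixProd m k =
    ∣-byν (*-pres->0 (P>0 m) (P>0 k)) (P>0 (m + k)) λ p p-prime → begin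
      ν p (P m * P k)                                 ≡⟨ ν-* p-prime (P>0 m) (P>0 k) ⟩
      ν p (P m) + ν p (P k)                           ≡⟨ cong₂ _+_ (ν-P p-prime m) (ν-P p-prime k) ⟩
      sumUpTo (ν p ∘ a) m + sumUpTo (ν p ∘ a) k       ≤⟨ sumUpTo-superadditive (ν-gcdToMin p-prime) m k ⟩
      sumUpTo (ν p ∘ a) (m + k)                       ≡⟨ ν-P p-prime (m + k) ⟨
      ν p (P (m + k))                                 ∎
    where open ≤-Reasoning

  prefixProd*prefixProd*a∣prefixProd*lcmUpTo : ∀ {m k i} → m < i → i ≤ m + k →
    prefixProd a m * (prefixProd a k * a i) ∣ prefixProd a (m + k) * lcmUpTo a k
  prefixProd*prefixProd*a∣prefixProd*lcmUpTo {m} {k} {i} m<i i≤m+k =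
    ∣-byν (*-pres->0 (P>0 m) (*-pres->0 (P>0 k) 0<aᵢ)) (*-pres->0 (P>0 (m + k)) (L>0 k)) λ p p-prime → begin
      ν p (P m * (P k * a i))                    ≡⟨ ν-* p-prime (P>0 m) (*-pres->0 (P>0 k) 0<aᵢ) ⟩
      ν p (P m) + ν p (P k * a i)                ≡⟨ cong (ν p (P m) +_) (ν-* p-prime (P>0 k) 0<aᵢ) ⟩
      ν p (P m) + (ν p (P k) + ν p (a i))        ≡⟨ +-assoc (ν p (P m)) _ _ ⟨
      ν p (P m) + ν p (P k) + ν p (a i)
        ≡⟨ cong₂ (λ x y → x + y + ν p (a i)) (ν-P p-prime m) (ν-P p-prime k) ⟩
      sumUpTo (ν p ∘ a) m + sumUpTo (ν p ∘ a) k + ν p (a i)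
        ≤⟨ sumUpTo-superadditive+term (ν-gcdToMin p-prime) m<i i≤m+k ⟩
      sumUpTo (ν p ∘ a) (m + k) + maxUpTo (ν p ∘ a) k
        ≤⟨ +-mono-≤ (≤-reflexive (sym (ν-P p-prime (m + k)))) (maxUpTo-ν≤ν-lcmUpTo positive p-prime k) ⟩
      ν p (P (m + k)) + ν p (lcmUpTo a k)        ≡⟨ ν-* p-prime (P>0 (m + k)) (L>0 k) ⟨
      ν p (P (m + k) * lcmUpTo a k)              ∎
    where
    open ≤-Reasoning
    0<aᵢ : 0 < a i
    0<aᵢ = positive i (≤-<-trans z≤n m<i)

  fallingProd≡binomA*prefixProd : ∀ m k → fallingProd a (m + k) k ≡ binomA a (m + k) k * prefixProd a k
  fallingProd≡binomA*prefixProd m k = sym (m-div-n*n≡m (P>0 k) (*-cancelˡ-∣ (P m) {{>-nonZero (P>0 m)}}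
    (subst (P m * P k ∣_) (prefixProd-+ a m k) (prefixProd*prefixProd∣prefixProd m k))))

  a∣binomA*lcmUpTo : ∀ {m k i} → m < i → i ≤ m + k → a i ∣ binomA a (m + k) k * lcmUpTo a k
  a∣binomA*lcmUpTo {m} {k} {i} m<i i≤m+k =
    *-cancelˡ-∣ (P k) {{>-nonZero (P>0 k)}} (*-cancelˡ-∣ (P m) {{>-nonZero (P>0 m)}}
      (subst (P m * (P k * a i) ∣_) P[m+k]*L≡ (prefixProd*prefixProd*a∣prefixProd*lcmUpTo m<i i≤m+k)))
    where
    B L : ℕ
    B = binomA a (m + k) k
    L = lcmUpTo a k
    P[m+k]*L≡ : P (m + k) * L ≡ P m * (P k * (B * L))
    P[m+k]*L≡ = begin
      P (m + k) * L                          ≡⟨ cong (_* L) (prefixProd-+ a m k) ⟩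
      P m * fallingProd a (m + k) k * L      ≡⟨ cong (λ F → P m * F * L) (fallingProd≡binomA*prefixProd m k) ⟩
      P m * (B * P k) * L                    ≡⟨ *-assoc (P m) (B * P k) L ⟩
      P m * (B * P k * L)                    ≡⟨ cong (λ x → P m * (x * L)) (*-comm B (P k)) ⟩
      P m * (P k * B * L)                    ≡⟨ cong (P m *_) (*-assoc (P k) B L) ⟩
      P m * (P k * (B * L))                  ∎
      where open ≡-Reasoning

  lcmUpTo-∣-binomA*lcmUpTo : ∀ {n k} → k ≤ n → n ≤ k + k → lcmUpTo a n ∣ binomA a n k * lcmUpTo a k
  lcmUpTo-∣-binomA*lcmUpTo {n} {k} k≤n n≤k+k =
    subst (λ n → lcmUpTo a n ∣ binomA a n k * lcmUpTo a k) (m∸n+n≡m k≤n) (lcmUpTo-least a (m + k) a∣term)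
    where
    m : ℕ
    m = n ∸ k
    a∣term : ∀ j → 0 < j → j ≤ m + k → a j ∣ binomA a (m + k) k * lcmUpTo a k
    a∣term j 0<j j≤m+k with j ≤? k
    ... | yes j≤k = ∣n⇒∣m*n (binomA a (m + k) k) (a∣lcmUpTo a 0<j j≤k)
    ... | no  j≰k = a∣binomA*lcmUpTo (≤-<-trans (m≤n+o⇒m∸n≤o n k n≤k+k) (≰⇒> j≰k)) j≤m+k

gcdHalf-greatest : ∀ f n m {d} → (∀ k → k ≤ m → n ≤ k + k → d ∣ f k) → d ∣ gcdHalf f n m
gcdHalf-greatest f n zero    d∣f with n ≤? 0
... | yes n≤0 = d∣f 0 z≤n n≤0
... | no  _   = _ ∣0
gcdHalf-greatest f n (suc m) d∣f with n ≤? suc m + suc m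
... | yes n≤2m = gcd-greatest (gcdHalf-greatest f n m (λ k k≤m → d∣f k (m≤n⇒m≤1+n k≤m)))
                              (d∣f (suc m) ≤-refl n≤2m)
... | no  _    = gcdHalf-greatest f n m (λ k k≤m → d∣f k (m≤n⇒m≤1+n k≤m))

gcdHalf∣f : ∀ f n {k m} → k ≤ m → n ≤ k + k → gcdHalf f n m ∣ f k
gcdHalf∣f f n {m = zero} z≤n n≤0 with n ≤? 0
... | yes _   = ∣-refl
... | no  n≰0 = contradiction n≤0 n≰0
gcdHalf∣f f n {k} {suc m} k≤1+m n≤2k with n ≤? suc m + suc m | m≤n⇒m<n∨m≡n k≤1+m
... | yes _   | inj₁ k<1+m =
  ∣-trans (gcd[m,n]∣m (gcdHalf f n m) (f (suc m))) (gcdHalf∣f f n (s≤s⁻¹ k<1+m) n≤2k)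
... | yes _   | inj₂ refl  = gcd[m,n]∣n (gcdHalf f n m) (f (suc m))
... | no  _   | inj₁ k<1+m = gcdHalf∣f f n (s≤s⁻¹ k<1+m) n≤2k
... | no  n≰  | inj₂ refl  = contradiction n≤2k n≰

corollary2 : (a : ℕ → ℕ) → IsStrongDivSeq a → (n : ℕ) → 1 ≤ n →
    lcmUpTo a n ≡ gcdHalf (λ k → binomA a n k * lcmUpTo a k) n n
corollary2 a sds n _ = ∣-antisym
  (gcdHalf-greatest term n n (λ k k≤n n≤2k → lcmUpTo-∣-binomA*lcmUpTo sds k≤n n≤2k))
  (subst (gcdHalf term n n ∣_) term[n]≡lcmUpTo (gcdHalf∣f term n {n} ≤-refl (m≤m+n n n)))
  where
  term : ℕ → ℕ
  term k = binomA a n k * lcmUpTo a k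
  term[n]≡lcmUpTo : term n ≡ lcmUpTo a n
  term[n]≡lcmUpTo = trans (cong (_* lcmUpTo a n) (binomA-diag (IsStrongDivSeq.positive sds) n)) (*-identityˡ _)
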